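{- For every integer $k\ge1$, the vector space $W_k$ has dimension $\frac12 k(k+5)$, which equals $\dim T_{k+1}-2$.
   Context: $T_{m}$ is the real vector space of arrays $(a_{ij})_{0\le i\le j\le m}$ with $a_{00}=0$ (dimension $\binom{m+2}{2}-1$). $V_k$ is the real vector space of labelings $X=(x_{ij},y_{ij},z_{ij})_{1\le i\le j\le k}$ (dimension $3\binom{k+1}{2}$), and $W_k\subseteq V_k$ is the subspace of those satisfying, for all $1\le i\le j<k$: (BZ1) $y_{ij}+z_{ij}=y_{i+1\,j+1}+z_{i\,j+1}$; (BZ2) $x_{i\,j+1}+y_{ij}=x_{i+1\,j+1}+y_{i+1\,j+1}$; (BZ3) $x_{i\,j+1}+z_{i\,j+1}=x_{i+1\,j+1}+z_{ij}$.
   Formalization: The labelings in $V_k$ and $W_k$ take rational values, and both are taken as vector spaces over ℚ instead of as real vector spaces. -}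

module Defs where

open import Data.Nat using (ℕ; zero; suc; _≤_; _<_; s≤s; z≤n; _∸_)
open import Data.Nat.Properties using (≤-trans; n≤1+n; ≤-step)
open import Data.Nat.Combinatorics using (_C_)
open import Data.Fin using (Fin; zero; suc)
open import Data.Rational using (ℚ; 0ℚ; _+_; _*_)
open import Data.Product using (Σ; _×_; _,_)
open import Relation.Binary.PropositionalEquality using (_≡_)

record Pos (k : ℕ) : Set where
  constructor pos
  field
    i   : ℕ
    j   : ℕ
    1≤i : 1 ≤ i
    i≤j : i ≤ j
    j≤k : j ≤ k

data Lab : Set where
  x y z : Lab

V : ℕ → Set
V k = Lab → Pos k → ℚ

_≐_ : ∀ {k} → V k → V k → Set
_≐_ {k} X Y = ∀ (l : Lab) (p : Pos k) → X l p ≡ Y l p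

P-ij : ∀ {k} i j → 1 ≤ i → i ≤ j → suc j ≤ k → Pos k
P-ij i j h1 h2 h3 = pos i j h1 h2 (≤-trans (n≤1+n j) h3)

P-i+1j+1 : ∀ {k} i j → 1 ≤ i → i ≤ j → suc j ≤ k → Pos k
P-i+1j+1 i j h1 h2 h3 = pos (suc i) (suc j) (s≤s z≤n) (s≤s h2) h3

P-ij+1 : ∀ {k} i j → 1 ≤ i → i ≤ j → suc j ≤ k → Pos k
P-ij+1 i j h1 h2 h3 = pos i (suc j) h1 (≤-trans h2 (n≤1+n j)) h3

InW : (k : ℕ) → V k → Set
InW k X = ∀ (i j : ℕ) (h1 : 1 ≤ i) (h2 : i ≤ j) (h3 : j < k) →
  let a = P-ij i j h1 h2 h3
      b = P-i+1j+1 i j h1 h2 h3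
      c = P-ij+1 i j h1 h2 h3
  in (X y a + X z a ≡ X y b + X z c)      -- BZ1
   × (X x c + X y a ≡ X x b + X y b)      -- BZ2
   × (X x c + X z c ≡ X x b + X z a)      -- BZ3

∑ : ∀ {d} → (Fin d → ℚ) → ℚ
∑ {zero}  f = 0ℚ
∑ {suc d} f = f zero + ∑ (λ t → f (suc t))

lincomb : ∀ {k d} → (Fin d → ℚ) → (Fin d → V k) → V k
lincomb c b l p = ∑ (λ t → c t * b t l p)

0V : ∀ {k} → V k
0V l p = 0ℚ

record IsBasis (k d : ℕ) (S : V k → Set) (b : Fin d → V k) : Set where
  field
    inS         : ∀ t → S (b t)
    independent : ∀ (c : Fin d → ℚ) → lincomb c b ≐ 0V → ∀ t → c t ≡ 0ℚ
    spanning    : ∀ (X : V k) → S X → Σ (Fin d → ℚ) (λ c → lincomb c b ≐ X)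

HasDim : (k : ℕ) → (V k → Set) → ℕ → Set
HasDim k S d = Σ (Fin d → V k) (IsBasis k d S)

dimT : ℕ → ℕ
dimT m = (m Data.Nat.+ 2) C 2 ∸ 1

{-# OPTIONS --safe #-}
module Submission where

-- The free coordinates of a labeling are x₁ⱼ, y₁ⱼ (1 ≤ j ≤ k) and zᵢⱼ (1 ≤ i ≤ j ≤ k),
-- 2k + k(k+1)/2 = k(k+5)/2 of them.  Solving (BZ1) for y_{i+1,j+1} and (BZ2) for
-- x_{i+1,j+1} recovers all other entries row by row, and (BZ3) is the difference of
-- (BZ2) and (BZ1), so every choice of free coordinates extends uniquely to an element
-- of W_k.  Thus evaluation at the free coordinates is a linear isomorphism from W_k
-- onto ℚ^(k(k+5)/2), and the preimages of the unit vectors form a basis.  Counting the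
-- free coordinates column by column gives binom(k+3, 2) − 3 = dim T_{k+1} − 2.

open import Defs
open import Data.Nat using (ℕ; _≤_; _+_; _*_; _∸_)
open import Data.Nat using (zero; suc; s≤s; z≤n; _≟_; _<?_)
open import Data.Nat.DivMod using (_/_)
open import Data.Product using (_×_)
open import Relation.Binary.PropositionalEquality using (_≡_)

open import Algebra.Bundles using (CommutativeRing)
open import Data.Fin using (Fin; zero; suc; toℕ; fromℕ<; _↑ˡ_; _↑ʳ_; splitAt)
open import Data.Fin.Properties
  using (toℕ≤pred[n]; toℕ<n; toℕ-fromℕ<; fromℕ<-toℕ; splitAt-↑ˡ; splitAt-↑ʳ; splitAt⁻¹-↑ˡ; splitAt⁻¹-↑ʳ)
open import Data.Nat.Combinatorics using (_C_; nCk+nC[k+1]≡[n+1]C[k+1]; nC1≡n)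
open import Data.Nat.DivMod using (m*n/n≡m)
open import Data.Nat.Properties as ℕ using (≤-refl; m≤n⇒m≤1+n; ≤-irrelevant; ≤-pred; ≤∧≢⇒<)
open import Data.Nat.Tactic.RingSolver using (solve)
open import Data.List using (_∷_; [])
open import Data.Product using (Σ-syntax; ∃-syntax; _,_; proj₁; proj₂; map₂; uncurry)
open import Data.Rational using (ℚ; 0ℚ; 1ℚ; _-_) renaming (_+_ to _+ℚ_; _*_ to _*ℚ_)
import Data.Rational.Properties as ℚ
open import Data.Rational.Solver using (module +-*-Solver)
open import Data.Sum using (inj₁; inj₂; [_,_]′)
open import Function using (_∘_)
open import Relation.Binary.PropositionalEquality using (refl; sym; trans; cong; cong₂; subst; _≗_; module ≡-Reasoning)
open import Relation.Nullary using (yes; no; contradiction)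

open import Algebra.Properties.Group ℚ.+-0-group using (∙-cancelʳ; //-rightDividesˡ)
open import Algebra.Properties.Semiring.Sum (CommutativeRing.semiring ℚ.+-*-commutativeRing)
  using (sum; sum-cong-≗; ∑-distrib-+; *-distribʳ-sum)

open ≡-Reasoning

∑≡sum : ∀ {n} (f : Fin n → ℚ) → ∑ f ≡ sum f
∑≡sum {zero} f = refl
∑≡sum {suc n} f = cong (f zero +ℚ_) (∑≡sum (f ∘ suc))

∑-cong : ∀ {n} {f g : Fin n → ℚ} → f ≗ g → ∑ f ≡ ∑ g
∑-cong {f = f} {g} f≗g = begin
  ∑ f   ≡⟨ ∑≡sum f ⟩
  sum f ≡⟨ sum-cong-≗ f≗g ⟩
  sum g ≡⟨ ∑≡sum g ⟨
  ∑ g   ∎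

∑-*-+ : ∀ {n} (w a b : Fin n → ℚ) →
  ∑ (λ t → w t *ℚ a t) +ℚ ∑ (λ t → w t *ℚ b t) ≡ ∑ (λ t → w t *ℚ (a t +ℚ b t))
∑-*-+ w a b = begin
  ∑ wa +ℚ ∑ wb               ≡⟨ cong₂ _+ℚ_ (∑≡sum wa) (∑≡sum wb) ⟩
  sum wa +ℚ sum wb           ≡⟨ ∑-distrib-+ wa wb ⟨
  sum (λ t → wa t +ℚ wb t)   ≡⟨ sum-cong-≗ (λ t → ℚ.*-distribˡ-+ (w t) (a t) (b t)) ⟨
  sum w[a+b]                 ≡⟨ ∑≡sum w[a+b] ⟨
  ∑ w[a+b]                   ∎
  where
  wa wb w[a+b] : Fin _ → ℚ
  wa t = w t *ℚ a t
  wb t = w t *ℚ b t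
  w[a+b] t = w t *ℚ (a t +ℚ b t)

∑-preserves-+≡+ : ∀ {n} (w : Fin n → ℚ) {a b c e : Fin n → ℚ} → (∀ t → a t +ℚ b t ≡ c t +ℚ e t) →
  ∑ (λ t → w t *ℚ a t) +ℚ ∑ (λ t → w t *ℚ b t) ≡ ∑ (λ t → w t *ℚ c t) +ℚ ∑ (λ t → w t *ℚ e t)
∑-preserves-+≡+ w {a} {b} {c} {e} eq = begin
  _ ≡⟨ ∑-*-+ w a b ⟩
  _ ≡⟨ ∑-cong (λ t → cong (w t *ℚ_) (eq t)) ⟩
  _ ≡⟨ ∑-*-+ w c e ⟨
  _ ∎

∑-*-zeroʳ : ∀ {n} (c : Fin n → ℚ) → ∑ (λ t → c t *ℚ 0ℚ) ≡ 0ℚ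
∑-*-zeroʳ c = begin
  ∑ (λ t → c t *ℚ 0ℚ)   ≡⟨ ∑≡sum (λ t → c t *ℚ 0ℚ) ⟩
  sum (λ t → c t *ℚ 0ℚ) ≡⟨ *-distribʳ-sum 0ℚ c ⟨
  sum c *ℚ 0ℚ           ≡⟨ ℚ.*-zeroʳ (sum c) ⟩
  0ℚ                    ∎

δ : ∀ {n} → Fin n → Fin n → ℚ
δ zero    zero    = 1ℚ
δ zero    (suc _) = 0ℚ
δ (suc _) zero    = 0ℚ
δ (suc s) (suc t) = δ s t

∑-δ : ∀ {n} (c : Fin n → ℚ) (s : Fin n) → ∑ (λ t → c t *ℚ δ t s) ≡ c s
∑-δ c zero = begin
  c zero *ℚ 1ℚ +ℚ ∑ (λ t → c (suc t) *ℚ 0ℚ) ≡⟨ cong₂ _+ℚ_ (ℚ.*-identityʳ (c zero)) (∑-*-zeroʳ (c ∘ suc)) ⟩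
  c zero +ℚ 0ℚ                              ≡⟨ ℚ.+-identityʳ (c zero) ⟩
  c zero                                    ∎
∑-δ c (suc s) = begin
  c zero *ℚ 0ℚ +ℚ ∑ (λ t → c (suc t) *ℚ δ t s) ≡⟨ cong₂ _+ℚ_ (ℚ.*-zeroʳ (c zero)) (∑-δ (c ∘ suc) s) ⟩
  0ℚ +ℚ c (suc s)                              ≡⟨ ℚ.+-identityˡ (c (suc s)) ⟩
  c (suc s)                                    ∎

module _ {k d : ℕ} (S : V k → Set) (coord : Fin d → Lab × Pos k) where

  hasDim-by-coordinates :
    (∀ (c : Fin d → ℚ) (b : Fin d → V k) → (∀ t → S (b t)) → S (lincomb c b)) →
    (∀ {X Y} → S X → S Y → (∀ t → uncurry X (coord t) ≡ uncurry Y (coord t)) → X ≐ Y) →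
    (∀ (c : Fin d → ℚ) → Σ[ X ∈ V k ] S X × (∀ t → uncurry X (coord t) ≡ c t)) →
    HasDim k S d
  hasDim-by-coordinates closed determined realize =
    b , record { inS = b∈S ; independent = independent ; spanning = spanning }
    where
    b : Fin d → V k
    b t = proj₁ (realize (δ t))

    b∈S : ∀ t → S (b t)
    b∈S t = proj₁ (proj₂ (realize (δ t)))

    lincomb-coord : ∀ c s → uncurry (lincomb c b) (coord s) ≡ c s
    lincomb-coord c s = trans (∑-cong (λ t → cong (c t *ℚ_) (proj₂ (proj₂ (realize (δ t))) s))) (∑-δ c s)

    independent : ∀ c → lincomb c b ≐ 0V → ∀ s → c s ≡ 0ℚ
    independent c c·b≐0 s = trans (sym (lincomb-coord c s)) (uncurry c·b≐0 (coord s))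

    spanning : ∀ X → S X → Σ[ c ∈ (Fin d → ℚ) ] lincomb c b ≐ X
    spanning X X∈S = coords , determined (closed coords b b∈S) X∈S (lincomb-coord coords)
      where
      coords : Fin d → ℚ
      coords t = uncurry X (coord t)

p≡p-q+q : ∀ p q → p ≡ (p - q) +ℚ q
p≡p-q+q p q = sym (//-rightDividesˡ q p)

+≡+-unique : ∀ {a b c e a′ b′ c′ e′ : ℚ} → a +ℚ b ≡ c +ℚ e → a′ +ℚ b′ ≡ c′ +ℚ e′ →
  a ≡ a′ → b ≡ b′ → e ≡ e′ → c ≡ c′
+≡+-unique {e = e} {c′ = c′} eq eq′ refl refl refl = ∙-cancelʳ e _ c′ (trans (sym eq) eq′)

+≡+-difference : ∀ {a b c e p q : ℚ} → a +ℚ b ≡ c +ℚ e → p +ℚ a ≡ q +ℚ c → p +ℚ e ≡ q +ℚ b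
+≡+-difference {a} {b} {c} {e} {p} {q} eq₁ eq₂ = begin
  p +ℚ e                                  ≡⟨ solveℚ 4 (λ p a b e → p :+ e := ((p :+ a) :+ (b :+ e)) :- (a :+ b)) refl p a b e ⟩
  ((p +ℚ a) +ℚ (b +ℚ e)) - (a +ℚ b)      ≡⟨ cong₂ (λ u v → (u +ℚ (b +ℚ e)) - v) eq₂ eq₁ ⟩
  ((q +ℚ c) +ℚ (b +ℚ e)) - (c +ℚ e)      ≡⟨ solveℚ 4 (λ q c b e → ((q :+ c) :+ (b :+ e)) :- (c :+ e) := q :+ b) refl q c b e ⟩
  q +ℚ b                                  ∎
  where open +-*-Solver renaming (solve to solveℚ)

InW-lincomb : ∀ {k d} (c : Fin d → ℚ) (b : Fin d → V k) → (∀ t → InW k (b t)) → InW k (lincomb c b)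
InW-lincomb c b b∈W i j 1≤i i≤j j<k =
    ∑-preserves-+≡+ c (proj₁ ∘ bz)
  , ∑-preserves-+≡+ c (proj₁ ∘ proj₂ ∘ bz)
  , ∑-preserves-+≡+ c (proj₂ ∘ proj₂ ∘ bz)
  where bz = λ t → b∈W t i j 1≤i i≤j j<k

data Free : Lab → ℕ → Set where
  x-free : Free x 1
  y-free : Free y 1
  z-free : ∀ {i} → Free z i

module _ {k} {X Y : V k} (X∈W : InW k X) (Y∈W : InW k Y)
         (agree-free : ∀ l p → Free l (Pos.i p) → X l p ≡ Y l p) where

  private
    agree-y : ∀ i j 1≤i i≤j j≤k → X y (pos i j 1≤i i≤j j≤k) ≡ Y y (pos i j 1≤i i≤j j≤k)
    agree-y 1 _ _ _ _ = agree-free y _ y-free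
    agree-y (suc (suc i)) (suc j) (s≤s z≤n) (s≤s i≤j) j<k =
      +≡+-unique (bz1 X X∈W) (bz1 Y Y∈W) (agree-y (suc i) j _ i≤j _) (agree-free z _ z-free) (agree-free z _ z-free)
      where bz1 = λ (W : V k) (W∈W : InW k W) → proj₁ (W∈W (suc i) j (s≤s z≤n) i≤j j<k)

    agree-x : ∀ i j 1≤i i≤j j≤k → X x (pos i j 1≤i i≤j j≤k) ≡ Y x (pos i j 1≤i i≤j j≤k)
    agree-x 1 _ _ _ _ = agree-free x _ x-free
    agree-x (suc (suc i)) (suc j) (s≤s z≤n) (s≤s i≤j) j<k =
      +≡+-unique (bz2 X X∈W) (bz2 Y Y∈W)
        (agree-x (suc i) (suc j) _ _ j<k) (agree-y (suc i) j _ i≤j _) (agree-y (suc (suc i)) (suc j) _ _ j<k)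
      where bz2 = λ (W : V k) (W∈W : InW k W) → proj₁ (proj₂ (W∈W (suc i) j (s≤s z≤n) i≤j j<k))

  InW-determined-by-free : X ≐ Y
  InW-determined-by-free x (pos i j 1≤i i≤j j≤k) = agree-x i j 1≤i i≤j j≤k
  InW-determined-by-free y (pos i j 1≤i i≤j j≤k) = agree-y i j 1≤i i≤j j≤k
  InW-determined-by-free z p                     = agree-free z p z-free

-- Labelings indexed by all of ℕ × ℕ, so that completion needs no bounds proofs.
RawLabeling : Set
RawLabeling = Lab → ℕ → ℕ → ℚ

_at_ : ∀ {k} → RawLabeling → Lab × Pos k → ℚ
G at (l , p) = G l (Pos.i p) (Pos.j p)

-- (BZ1) solved for y_{i+1,j+1} and (BZ2) for x_{i+1,j+1}.
completeY : RawLabeling → ℕ → ℕ → ℚ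
completeY G (suc (suc i)) (suc j) = (completeY G (suc i) j +ℚ G z (suc i) j) - G z (suc i) (suc j)
completeY G i j = G y i j

completeX : RawLabeling → ℕ → ℕ → ℚ
completeX G (suc (suc i)) (suc j) =
  (completeX G (suc i) (suc j) +ℚ completeY G (suc i) j) - completeY G (suc (suc i)) (suc j)
completeX G i j = G x i j

complete : ∀ {k} → RawLabeling → V k
complete G x p = completeX G (Pos.i p) (Pos.j p)
complete G y p = completeY G (Pos.i p) (Pos.j p)
complete G z p = G z (Pos.i p) (Pos.j p)

complete-free : ∀ {k} (G : RawLabeling) (s : Lab × Pos k) → Free (proj₁ s) (Pos.i (proj₂ s)) →
  uncurry (complete G) s ≡ G at s
complete-free G (x , _) x-free = refl
complete-free G (y , _) y-free = refl
complete-free G (z , _) z-free = refl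

complete-InW : ∀ k (G : RawLabeling) → InW k (complete G)
complete-InW k G (suc i) j (s≤s z≤n) _ _ = bz1 , bz2 , +≡+-difference {y₀} {z₀} {y₁} {z₁} {x₀} {x₁} bz1 bz2
  where
  x₀ = completeX G (suc i) (suc j)
  x₁ = completeX G (suc (suc i)) (suc j)
  y₀ = completeY G (suc i) j
  y₁ = completeY G (suc (suc i)) (suc j)
  z₀ = G z (suc i) j
  z₁ = G z (suc i) (suc j)

  bz1 : y₀ +ℚ z₀ ≡ y₁ +ℚ z₁
  bz1 = p≡p-q+q (y₀ +ℚ z₀) z₁

  bz2 : x₀ +ℚ y₀ ≡ x₁ +ℚ y₁
  bz2 = p≡p-q+q (x₀ +ℚ y₀) y₁

-- Column j = k+1 carries the free coordinates x₁ⱼ, y₁ⱼ and z₁ⱼ, …, z_{k+1,j}.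
dimW : ℕ → ℕ
dimW zero    = 0
dimW (suc k) = dimW k + (3 + k)

Pos-≡ : ∀ {k} {p q : Pos k} → Pos.i p ≡ Pos.i q → Pos.j p ≡ Pos.j q → p ≡ q
Pos-≡ {p = pos i j a b c} {pos .i .j a′ b′ c′} refl refl
  rewrite ≤-irrelevant a a′ | ≤-irrelevant b b′ | ≤-irrelevant c c′ = refl

Pos-inject₁ : ∀ {k} → Pos k → Pos (suc k)
Pos-inject₁ (pos i j 1≤i i≤j j≤k) = pos i j 1≤i i≤j (m≤n⇒m≤1+n j≤k)

column : ∀ k → Fin (3 + k) → Lab × Pos (suc k)
column k zero             = x , pos 1 (suc k) (s≤s z≤n) (s≤s z≤n) ≤-refl
column k (suc zero)       = y , pos 1 (suc k) (s≤s z≤n) (s≤s z≤n) ≤-refl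
column k (suc (suc row))  = z , pos (suc (toℕ row)) (suc k) (s≤s z≤n) (s≤s (toℕ≤pred[n] row)) ≤-refl

slot : ∀ k → Fin (dimW k) → Lab × Pos k
slot (suc k) t = [ map₂ Pos-inject₁ ∘ slot k , column k ]′ (splitAt (dimW k) t)

slot-↑ˡ : ∀ k u → slot (suc k) (u ↑ˡ (3 + k)) ≡ map₂ Pos-inject₁ (slot k u)
slot-↑ˡ k u = cong [ map₂ Pos-inject₁ ∘ slot k , column k ]′ (splitAt-↑ˡ (dimW k) u (3 + k))

slot-↑ʳ : ∀ k v → slot (suc k) (dimW k ↑ʳ v) ≡ column k v
slot-↑ʳ k v = cong [ map₂ Pos-inject₁ ∘ slot k , column k ]′ (splitAt-↑ʳ (dimW k) (3 + k) v)

column-top : ∀ k v → Pos.j (proj₂ (column k v)) ≡ suc k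
column-top k zero          = refl
column-top k (suc zero)    = refl
column-top k (suc (suc _)) = refl

column-free : ∀ k v → Free (proj₁ (column k v)) (Pos.i (proj₂ (column k v)))
column-free k zero           = x-free
column-free k (suc zero)     = y-free
column-free k (suc (suc _))  = z-free

slot-free : ∀ k t → Free (proj₁ (slot k t)) (Pos.i (proj₂ (slot k t)))
slot-free (suc k) t with splitAt (dimW k) t
... | inj₁ u = slot-free k u
... | inj₂ v = column-free k v

column-surjective : ∀ k l (p : Pos (suc k)) → Free l (Pos.i p) → Pos.j p ≡ suc k → ∃[ v ] column k v ≡ (l , p)
column-surjective k x p x-free refl = zero , cong (x ,_) (Pos-≡ refl refl)
column-surjective k y p y-free refl = suc zero , cong (y ,_) (Pos-≡ refl refl)
column-surjective k z (pos (suc i) _ (s≤s z≤n) (s≤s i≤k) _) z-free refl =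
  suc (suc (fromℕ< (s≤s i≤k))) , cong (z ,_) (Pos-≡ (cong suc (toℕ-fromℕ< (s≤s i≤k))) refl)

slot-surjective : ∀ k l (p : Pos k) → Free l (Pos.i p) → ∃[ t ] slot k t ≡ (l , p)
slot-surjective zero l (pos _ _ (s≤s z≤n) (s≤s _) ()) _
slot-surjective (suc k) l p free with Pos.j p ≟ suc k
... | yes j≡1+k = let (v , eq) = column-surjective k l p free j≡1+k in dimW k ↑ʳ v , trans (slot-↑ʳ k v) eq
... | no  j≢1+k =
  let (u , eq) = slot-surjective k l p′ free
  in  u ↑ˡ (3 + k) , (begin
        slot (suc k) (u ↑ˡ (3 + k))  ≡⟨ slot-↑ˡ k u ⟩
        map₂ Pos-inject₁ (slot k u)  ≡⟨ cong (map₂ Pos-inject₁) eq ⟩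
        l , Pos-inject₁ p′           ≡⟨ cong (l ,_) (Pos-≡ refl refl) ⟩
        l , p                        ∎)
  where
  p′ : Pos k
  p′ = pos (Pos.i p) (Pos.j p) (Pos.1≤i p) (Pos.i≤j p) (≤-pred (≤∧≢⇒< (Pos.j≤k p) j≢1+k))

readColumn : ∀ k → (Fin (3 + k) → ℚ) → Lab → ℕ → ℚ
readColumn k c x 1 = c zero
readColumn k c y 1 = c (suc zero)
readColumn k c z (suc i) with i <? suc k
... | yes i<1+k = c (suc (suc (fromℕ< i<1+k)))
... | no  _     = 0ℚ
readColumn k c _ _ = 0ℚ

read : ∀ k → (Fin (dimW k) → ℚ) → RawLabeling
read zero    c _ _ _ = 0ℚ
read (suc k) c l i j with j ≟ suc k
... | yes _ = readColumn k (c ∘ (dimW k ↑ʳ_)) l i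
... | no  _ = read k (c ∘ (_↑ˡ (3 + k))) l i j

read-below : ∀ k c l i j → j ≤ k → read (suc k) c l i j ≡ read k (c ∘ (_↑ˡ (3 + k))) l i j
read-below k c l i j j≤k with j ≟ suc k
... | yes refl = contradiction j≤k ℕ.1+n≰n
... | no  _    = refl

read-top : ∀ k c l i j → j ≡ suc k → read (suc k) c l i j ≡ readColumn k (c ∘ (dimW k ↑ʳ_)) l i
read-top k c l i _ refl with suc k ≟ suc k
... | yes _   = refl
... | no  1+k≢1+k = contradiction refl 1+k≢1+k

read-column : ∀ k c v → readColumn k c (proj₁ (column k v)) (Pos.i (proj₂ (column k v))) ≡ c v
read-column k c zero       = refl
read-column k c (suc zero) = refl
read-column k c (suc (suc row)) with toℕ row <? suc k
... | yes row<1+k = cong (λ r → c (suc (suc r))) (fromℕ<-toℕ row row<1+k)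
... | no  row≮1+k = contradiction (toℕ<n row) row≮1+k

read-slot : ∀ k c t → read k c at slot k t ≡ c t
read-slot (suc k) c t with splitAt (dimW k) t in split≡
... | inj₁ u = begin
  read (suc k) c at map₂ Pos-inject₁ (slot k u) ≡⟨ read-below k c _ _ _ (Pos.j≤k (proj₂ (slot k u))) ⟩
  read k (c ∘ (_↑ˡ (3 + k))) at slot k u       ≡⟨ read-slot k (c ∘ (_↑ˡ (3 + k))) u ⟩
  c (u ↑ˡ (3 + k))                              ≡⟨ cong c (splitAt⁻¹-↑ˡ split≡) ⟩
  c t                                           ∎
... | inj₂ v = begin
  read (suc k) c at column k v                  ≡⟨ read-top k c _ _ _ (column-top k v) ⟩
  readColumn k (c ∘ (dimW k ↑ʳ_)) (proj₁ (column k v)) (Pos.i (proj₂ (column k v)))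
                                                ≡⟨ read-column k (c ∘ (dimW k ↑ʳ_)) v ⟩
  c (dimW k ↑ʳ v)                               ≡⟨ cong c (splitAt⁻¹-↑ʳ split≡) ⟩
  c t                                           ∎

W-hasDim : ∀ k → HasDim k (InW k) (dimW k)
W-hasDim k = hasDim-by-coordinates (InW k) (slot k) InW-lincomb determined realize
  where
  determined : ∀ {X Y} → InW k X → InW k Y →
    (∀ t → uncurry X (slot k t) ≡ uncurry Y (slot k t)) → X ≐ Y
  determined {X} {Y} X∈W Y∈W agree = InW-determined-by-free X∈W Y∈W λ l p free →
    let (t , slot≡) = slot-surjective k l p free
    in  subst (λ s → uncurry X s ≡ uncurry Y s) slot≡ (agree t)

  realize : ∀ c → Σ[ X ∈ V k ] InW k X × (∀ t → uncurry X (slot k t) ≡ c t)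
  realize c = complete (read k c) , complete-InW k (read k c) ,
              λ t → trans (complete-free (read k c) (slot k t) (slot-free k t)) (read-slot k c t)

dimW*2≡k*[k+5] : ∀ k → dimW k * 2 ≡ k * (k + 5)
dimW*2≡k*[k+5] zero    = refl
dimW*2≡k*[k+5] (suc k) = begin
  (dimW k + (3 + k)) * 2        ≡⟨ ℕ.*-distribʳ-+ 2 (dimW k) (3 + k) ⟩
  dimW k * 2 + (3 + k) * 2      ≡⟨ cong (_+ (3 + k) * 2) (dimW*2≡k*[k+5] k) ⟩
  k * (k + 5) + (3 + k) * 2     ≡⟨ solve (k ∷ []) ⟩
  suc k * (suc k + 5)           ∎

[3+k]C2≡3+dimW : ∀ k → (3 + k) C 2 ≡ 3 + dimW k
[3+k]C2≡3+dimW zero    = refl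
[3+k]C2≡3+dimW (suc k) = begin
  (4 + k) C 2                   ≡⟨ nCk+nC[k+1]≡[n+1]C[k+1] (3 + k) 1 ⟨
  (3 + k) C 1 + (3 + k) C 2     ≡⟨ cong₂ _+_ (nC1≡n (3 + k)) ([3+k]C2≡3+dimW k) ⟩
  (3 + k) + (3 + dimW k)        ≡⟨ ℕ.+-comm (3 + k) (3 + dimW k) ⟩
  3 + (dimW k + (3 + k))        ∎

lemma5p1 : ∀ (k : ℕ) → 1 ≤ k →
    HasDim k (InW k) ((k * (k + 5)) / 2) × ((k * (k + 5)) / 2 ≡ dimT (k + 1) ∸ 2)
lemma5p1 k _ = subst (HasDim k (InW k)) (sym half) (W-hasDim k) , trans half (sym dimT≡)
  where
  half : (k * (k + 5)) / 2 ≡ dimW k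
  half = trans (cong (_/ 2) (sym (dimW*2≡k*[k+5] k))) (m*n/n≡m (dimW k) 2)

  dimT≡ : dimT (k + 1) ∸ 2 ≡ dimW k
  dimT≡ = begin
    (k + 1 + 2) C 2 ∸ 1 ∸ 2   ≡⟨ cong (λ n → n C 2 ∸ 1 ∸ 2) k+1+2≡3+k ⟩
    (3 + k) C 2 ∸ 1 ∸ 2       ≡⟨ cong (λ n → n ∸ 1 ∸ 2) ([3+k]C2≡3+dimW k) ⟩
    dimW k                    ∎
    where
    k+1+2≡3+k : k + 1 + 2 ≡ 3 + k
    k+1+2≡3+k = solve (k ∷ [])
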